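{- Let $d\ge 1$, let $\pi\in\mathbb{Z}^d_{>0}$ and let $T$ be a positive integer. Let $Q=\mathbb{Z}^d\cap\{c\in\mathbb{R}^d_{\ge 0}:\pi\cdot c\le T\}$, let $b\in\mathbb{R}^d$ and $m\in\mathbb{Z}_{\ge 0}$, and consider the integer program [conf-IP]: find $x\in\mathbb{Z}_{\ge 0}^{Q}$ with $\sum_{c\in Q} c\,x_c=b$ and $\sum_{c\in Q}x_c=m$. Assume [conf-IP] is feasible. Then there exists a feasible solution $x$ of [conf-IP] such that: (1) if $x_c>1$ then the configuration $c$ is simple; (2) $|\mathrm{supp}(x)|\le 4(d+1)\log(4(d+1)T)$; (3) $\sum_{c\in Q_c}x_c\le 2(d+1)\log(4(d+1)T)$, where $Q_c$ is the set of complex configurations.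
   Context: $\log=\log_2$. Elements of $Q$ are called configurations. For a vector $a$, $\mathrm{supp}(a)=\{i: a_i\neq 0\}$. A configuration $c\in Q$ is simple if $|\mathrm{supp}(c)|\le\log(T+1)$ and complex otherwise. -}

module Defs where

open import Data.Nat using (ℕ; zero; suc; _+_; _*_; _^_; _≤_; _<_; _≟_; _≤?_)
open import Data.Integer using (ℤ; +_)
open import Data.List using (List; []; _∷_; [_]; map; concatMap; upTo; filter; length)
open import Data.Nat.ListAction using (sum)
open import Data.Vec using (Vec; zipWith; replicate; toList; lookup) renaming (map to vmap; _∷_ to _∷ᵥ_; [] to []ᵥ)
open import Data.Fin using (Fin)
open import Relation.Nullary using (¬_; Dec; ¬?)
open import Relation.Binary.PropositionalEquality using (_≡_)
open import Data.Product using (Σ; _×_)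

dot : ∀ {d} → Vec ℕ d → Vec ℕ d → ℕ
dot u v = sum (toList (zipWith _*_ u v))

allVecs : (d T : ℕ) → List (Vec ℕ d)
allVecs zero    T = [ []ᵥ ]
allVecs (suc d) T = concatMap (λ i → map (i ∷ᵥ_) (allVecs d T)) (upTo (suc T))

-- Q = ℤ^d ∩ {c ≥ 0 : π · c ≤ T}, as a duplicate-free list.
-- (Since every π_i ≥ 1, each c ∈ Q has entries ≤ T.)
Q : ∀ {d} → Vec ℕ d → ℕ → List (Vec ℕ d)
Q {d} π T = filter (λ c → dot π c ≤? T) (allVecs d T)

suppSize : ∀ {d} → Vec ℕ d → ℕ
suppSize c = length (filter (λ a → ¬? (a ≟ 0)) (toList c))

-- c is simple iff |supp(c)| ≤ log₂(T+1), i.e. (as |supp c| is an integer) 2^|supp c| ≤ T+1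
Simple : ∀ {d} → ℕ → Vec ℕ d → Set
Simple T c = 2 ^ suppSize c ≤ T + 1

simple? : ∀ {d} (T : ℕ) (c : Vec ℕ d) → Dec (Simple T c)
simple? T c = 2 ^ suppSize c ≤? T + 1

complexConfigs : ∀ {d} → Vec ℕ d → ℕ → List (Vec ℕ d)
complexConfigs π T = filter (λ c → ¬? (simple? T c)) (Q π T)

weightedSum : ∀ {d} → List (Vec ℕ d) → (Vec ℕ d → ℕ) → Vec ℕ d
weightedSum {d} []       x = replicate d 0
weightedSum     (c ∷ cs) x = zipWith _+_ (vmap (x c *_) c) (weightedSum cs x)

total : ∀ {d} → List (Vec ℕ d) → (Vec ℕ d → ℕ) → ℕ
total cs x = sum (map x cs)

-- a solution x ∈ ℤ_{≥0}^Q is represented by x : ℕ^d → ℕ; only its values on Q matter.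
Feasible : ∀ {d} → Vec ℕ d → ℕ → Vec ℤ d → ℕ → (Vec ℕ d → ℕ) → Set
Feasible π T b m x = vmap +_ (weightedSum (Q π T) x) ≡ b × total (Q π T) x ≡ m

suppX : ∀ {d} → Vec ℕ d → ℕ → (Vec ℕ d → ℕ) → ℕ
suppX π T x = length (filter (λ c → ¬? (x c ≟ 0)) (Q π T))

-- Encode a solution by its coefficient vector y along the list of configurations and climb the
-- potential Φ y = K · Σ_c y_c ‖c‖² + ‖y‖², with K larger than any ‖y‖² of the same total m, which is
-- bounded on the solutions with the same image (Σ_c y_c, Σ_c y_c c). Two moves keep the image and
-- raise Φ. If a complex configuration c has y_c ≥ 2, then among the 2^|supp c| > T + 1 zero-one
-- vectors below supp c two distinct ones e, e′ have the same π-weight, and replacing c, c by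
-- c − e + e′, c − e′ + e strictly raises Σ_c y_c ‖c‖². If y, or its restriction to complex
-- configurations, has support size s with 2^s > (sT + 1)^(d+1), then two distinct zero-one vectors
-- below that support have the same image; shifting y by their difference in one of the two
-- directions raises ‖y‖² and keeps Σ_c y_c ‖c‖² on average. At a maximum of Φ neither move
-- applies, and 2^s ≤ (sT + 1)^(d+1) yields s ≤ 2(d+1) log(4(d+1)T).

module Submission where

open import Defs
open import Data.Nat
  using (ℕ; zero; suc; _+_; _*_; _∸_; _^_; _⊓_; _≤_; _<_; _≟_; _≤?_; _<?_; z≤n; s≤s; ∣_-_∣; >-nonZero)
open import Data.Nat.Properties
open import Data.Nat.DivMod using (_/_; _%_; m≡m%n+[m/n]*n; m%n<n)
open import Data.Nat.Tactic.RingSolver using (solve-∀)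
open import Data.Integer using (ℤ)
import Data.Integer as ℤ
open import Data.Fin as Fin using (Fin; zero; suc)
import Data.Fin.Properties as Fin
open import Data.List as List using (List; [_]; length; upTo; cartesianProductWith; filter)
open import Data.List.Properties using (length-++; length-map; length-upTo)
open import Data.List.Membership.Propositional using (_∈_)
open import Data.List.Membership.Propositional.Properties
  using (∈-lookup; ∈-upTo⁺; ∈-upTo⁻; ∈-cartesianProductWith⁺; ∈-cartesianProductWith⁻; ∈-filter⁺; ∈-filter⁻)
open import Data.List.Relation.Unary.Any using (here)
import Data.List.Relation.Unary.Any as Any
open import Data.List.Relation.Unary.Any.Properties using (lookup-index)
import Data.List.Relation.Unary.All as All
open import Data.List.Relation.Unary.AllPairs using ([]; _∷_)
open import Data.List.Relation.Unary.Unique.Propositional using (Unique)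
import Data.List.Relation.Unary.Unique.Propositional.Properties as Unique
open import Data.Vec as Vec using (Vec; []; _∷_; lookup; zipWith; replicate; tabulate)
open import Data.Vec.Relation.Binary.Pointwise.Inductive using (Pointwise; []; _∷_)
import Data.Vec.Relation.Binary.Pointwise.Inductive as Pointwise
import Data.Vec.Properties as Vec
open import Data.Product using (Σ; ∃; _×_; _,_; proj₁; proj₂)
open import Data.Sum as Sum using (_⊎_; inj₁; inj₂)
open import Relation.Nullary using (¬_; ¬?; Dec; yes; no; does; contradiction; _×-dec_)
open import Relation.Unary using (Decidable)
open import Relation.Binary using (DecidableEquality)
open import Data.Bool using (true; false; if_then_else_)
open import Function using (_∘_)
open import Relation.Binary.PropositionalEquality hiding ([_])
open import Algebra.Properties.CommutativeSemigroup +-commutativeSemigroup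
  using () renaming (interchange to +-interchange; xy∙z≈xz∙y to +-xy∙z≈xz∙y)
open import Algebra.Properties.CommutativeSemigroup *-commutativeSemigroup
  using () renaming (interchange to *-interchange)

infixl 6 _⊕_ _⊖_
infix 4 _≤ᵥ_

_⊕_ _⊖_ : ∀ {n} → Vec ℕ n → Vec ℕ n → Vec ℕ n
_⊕_ = zipWith _+_
_⊖_ = zipWith _∸_

_≤ᵥ_ : ∀ {n} → Vec ℕ n → Vec ℕ n → Set
_≤ᵥ_ = Pointwise _≤_

-- y − α + α′, an honest vector difference as long as α ≤ᵥ y
exchange : ∀ {n} → Vec ℕ n → Vec ℕ n → Vec ℕ n → Vec ℕ n
exchange y α α′ = y ⊖ α ⊕ α′

indicator : ∀ {n} → Vec ℕ n → Vec ℕ n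
indicator = Vec.map (1 ⊓_)

dist : ∀ {n} → Vec ℕ n → Vec ℕ n → ℕ
dist α α′ = Vec.sum (zipWith ∣_-_∣ α α′)

indicator-≤ : ∀ {n} (y : Vec ℕ n) → indicator y ≤ᵥ y
indicator-≤ []      = []
indicator-≤ (a ∷ y) = m⊓n≤n 1 a ∷ indicator-≤ y

indicator-mono-≤ : ∀ {n} {w y : Vec ℕ n} → w ≤ᵥ y → indicator w ≤ᵥ indicator y
indicator-mono-≤ = Pointwise.map⁺ (⊓-monoʳ-≤ 1)

dot-⊕ : ∀ {n} (r u v : Vec ℕ n) → dot r (u ⊕ v) ≡ dot r u + dot r v
dot-⊕ [] [] [] = refl
dot-⊕ (a ∷ r) (b ∷ u) (c ∷ v) = begin
  a * (b + c) + dot r (u ⊕ v)           ≡⟨ cong₂ _+_ (*-distribˡ-+ a b c) (dot-⊕ r u v) ⟩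
  (a * b + a * c) + (dot r u + dot r v) ≡⟨ +-interchange (a * b) (a * c) (dot r u) (dot r v) ⟩
  (a * b + dot r u) + (a * c + dot r v) ∎
  where open ≡-Reasoning

dot-monoʳ-≤ : ∀ {n} (r : Vec ℕ n) {u v} → u ≤ᵥ v → dot r u ≤ dot r v
dot-monoʳ-≤ [] [] = z≤n
dot-monoʳ-≤ (a ∷ r) (b≤c ∷ u≤v) = +-mono-≤ (*-monoʳ-≤ a b≤c) (dot-monoʳ-≤ r u≤v)

sum-mono-≤ : ∀ {n} {u v : Vec ℕ n} → u ≤ᵥ v → Vec.sum u ≤ Vec.sum v
sum-mono-≤ []          = z≤n
sum-mono-≤ (a≤b ∷ u≤v) = +-mono-≤ a≤b (sum-mono-≤ u≤v)

sum-indicator : ∀ {n} (w : Vec ℕ n) → Vec.sum (indicator w) ≡ suppSize w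
sum-indicator []          = refl
sum-indicator (zero  ∷ w) = sum-indicator w
sum-indicator (suc _ ∷ w) = cong suc (sum-indicator w)

sum-≤-suppSize : ∀ {n} (w : Vec ℕ n) → (∀ j → lookup w j ≤ 1) → Vec.sum w ≤ suppSize w
sum-≤-suppSize []      _   = z≤n
sum-≤-suppSize (a ∷ w) w≤1 with a | w≤1 zero
... | zero  | _         = sum-≤-suppSize w (w≤1 ∘ suc)
... | suc _ | s≤s z≤n   = s≤s (sum-≤-suppSize w (w≤1 ∘ suc))

lookup-≤-sum : ∀ {n} (c : Vec ℕ n) i → lookup c i ≤ Vec.sum c
lookup-≤-sum (a ∷ c) zero    = m≤m+n a (Vec.sum c)
lookup-≤-sum (a ∷ c) (suc i) = ≤-trans (lookup-≤-sum c i) (m≤n+m (Vec.sum c) a)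

sum-≤-dot : ∀ {n} (π c : Vec ℕ n) → (∀ i → 0 < lookup π i) → Vec.sum c ≤ dot π c
sum-≤-dot []      []      _   = z≤n
sum-≤-dot (p ∷ π) (a ∷ c) π>0 = +-mono-≤ (m≤n*m a p {{>-nonZero (π>0 zero)}}) (sum-≤-dot π c (π>0 ∘ suc))

dot-≤-sum : ∀ {n B} (r y : Vec ℕ n) → (∀ j → lookup r j ≤ B) → dot r y ≤ B * Vec.sum y
dot-≤-sum {B = B} []      []      _   = z≤n
dot-≤-sum {B = B} (b ∷ r) (a ∷ y) r≤B = begin
  b * a + dot r y         ≤⟨ +-mono-≤ (*-monoˡ-≤ a (r≤B zero)) (dot-≤-sum r y (r≤B ∘ suc)) ⟩
  B * a + B * Vec.sum y   ≡⟨ *-distribˡ-+ B a (Vec.sum y) ⟨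
  B * (a + Vec.sum y)     ∎
  where open ≤-Reasoning

dot-self-≤ : ∀ {n} (y : Vec ℕ n) → dot y y ≤ Vec.sum y * Vec.sum y
dot-self-≤ []      = z≤n
dot-self-≤ (a ∷ y) = begin
  a * a + dot y y                         ≤⟨ +-monoʳ-≤ (a * a) (dot-self-≤ y) ⟩
  a * a + s * s                           ≤⟨ m≤m+n (a * a + s * s) (2 * a * s) ⟩
  a * a + s * s + 2 * a * s               ≡⟨ square-sum a s ⟩
  (a + s) * (a + s)                       ∎
  where
  open ≤-Reasoning
  s = Vec.sum y
  square-sum : ∀ a s → a * a + s * s + 2 * a * s ≡ (a + s) * (a + s)
  square-sum = solve-∀

dot-ones : ∀ {n} (y : Vec ℕ n) → dot (tabulate λ _ → 1) y ≡ Vec.sum y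
dot-ones []      = refl
dot-ones (a ∷ y) = cong₂ _+_ (*-identityˡ a) (dot-ones y)

dot-zeros : ∀ {n} (r : Vec ℕ n) → dot r (replicate n 0) ≡ 0
dot-zeros []      = refl
dot-zeros (b ∷ r) = cong₂ _+_ (*-zeroʳ b) (dot-zeros r)

unit : ∀ {n} → Fin n → Vec ℕ n
unit {suc n} zero    = 1 ∷ replicate n 0
unit         (suc j) = 0 ∷ unit j

dot-unit : ∀ {n} (r : Vec ℕ n) j → dot r (unit j) ≡ lookup r j
dot-unit (b ∷ r) zero    = trans (cong₂ _+_ (*-identityʳ b) (dot-zeros r)) (+-identityʳ b)
dot-unit (b ∷ r) (suc j) = cong₂ _+_ (*-zeroʳ b) (dot-unit r j)

unit⊕unit-≤ : ∀ {n} (y : Vec ℕ n) j → 2 ≤ lookup y j → unit j ⊕ unit j ≤ᵥ y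
unit⊕unit-≤ (a ∷ y) zero    2≤a = 2≤a ∷ zeros-≤ y
  where
  zeros-≤ : ∀ {n} (y : Vec ℕ n) → replicate n 0 ⊕ replicate n 0 ≤ᵥ y
  zeros-≤ []      = []
  zeros-≤ (_ ∷ y) = z≤n ∷ zeros-≤ y
unit⊕unit-≤ (a ∷ y) (suc j) 2≤y = z≤n ∷ unit⊕unit-≤ y j 2≤y

-- Exchanges

exchange-⊕ : ∀ {n} {y α : Vec ℕ n} α′ → α ≤ᵥ y → exchange y α α′ ⊕ α ≡ y ⊕ α′
exchange-⊕ [] [] = refl
exchange-⊕ {y = u ∷ _} {a ∷ _} (a′ ∷ α′) (a≤u ∷ α≤y) =
  cong₂ _∷_ (trans (+-xy∙z≈xz∙y (u ∸ a) a′ a) (cong (_+ a′) (m∸n+n≡m a≤u))) (exchange-⊕ α′ α≤y)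

exchange-pair : ∀ {n} {y α α′ : Vec ℕ n} → α ≤ᵥ y → α′ ≤ᵥ y →
                exchange y α α′ ⊕ exchange y α′ α ≡ y ⊕ y
exchange-pair [] [] = refl
exchange-pair {y = u ∷ _} {a ∷ _} {a′ ∷ _} (a≤u ∷ α≤y) (a′≤u ∷ α′≤y) =
  cong₂ _∷_ head (exchange-pair α≤y α′≤y)
  where
  head : u ∸ a + a′ + (u ∸ a′ + a) ≡ u + u
  head = begin
    u ∸ a + a′ + (u ∸ a′ + a) ≡⟨ +-interchange (u ∸ a) a′ (u ∸ a′) a ⟩
    u ∸ a + (u ∸ a′) + (a′ + a) ≡⟨ cong (u ∸ a + (u ∸ a′) +_) (+-comm a′ a) ⟩
    u ∸ a + (u ∸ a′) + (a + a′) ≡⟨ +-interchange (u ∸ a) (u ∸ a′) a a′ ⟩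
    u ∸ a + a + (u ∸ a′ + a′)   ≡⟨ cong₂ _+_ (m∸n+n≡m a≤u) (m∸n+n≡m a′≤u) ⟩
    u + u                       ∎
    where open ≡-Reasoning

dot-exchange : ∀ {n} (r : Vec ℕ n) {y α : Vec ℕ n} α′ → α ≤ᵥ y →
               dot r (exchange y α α′) + dot r α ≡ dot r y + dot r α′
dot-exchange r {y} {α} α′ α≤y = begin
  dot r (exchange y α α′) + dot r α ≡⟨ dot-⊕ r (exchange y α α′) α ⟨
  dot r (exchange y α α′ ⊕ α)       ≡⟨ cong (dot r) (exchange-⊕ α′ α≤y) ⟩
  dot r (y ⊕ α′)                    ≡⟨ dot-⊕ r y α′ ⟩
  dot r y + dot r α′                ∎
  where open ≡-Reasoning

dot-exchange-invariant : ∀ {n} (r : Vec ℕ n) {y α α′ : Vec ℕ n} → α ≤ᵥ y →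
                         dot r α ≡ dot r α′ → dot r (exchange y α α′) ≡ dot r y
dot-exchange-invariant r {y} {α} {α′} α≤y eq =
  +-cancelʳ-≡ (dot r α) _ _ (trans (dot-exchange r α′ α≤y) (cong (dot r y +_) (sym eq)))

dot-exchange-pair : ∀ {n} (r : Vec ℕ n) {y α α′ : Vec ℕ n} → α ≤ᵥ y → α′ ≤ᵥ y →
                    dot r (exchange y α α′) + dot r (exchange y α′ α) ≡ dot r y + dot r y
dot-exchange-pair r {y} {α} {α′} α≤y α′≤y = begin
  dot r (exchange y α α′) + dot r (exchange y α′ α) ≡⟨ dot-⊕ r _ _ ⟨
  dot r (exchange y α α′ ⊕ exchange y α′ α)         ≡⟨ cong (dot r) (exchange-pair α≤y α′≤y) ⟩
  dot r (y ⊕ y)                                     ≡⟨ dot-⊕ r y y ⟩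
  dot r y + dot r y                                 ∎
  where open ≡-Reasoning

-- Coordinatewise (u − a + a′)² + (u − a′ + a)² = 2u² + 2(a − a′)², and (a − a′)² = ∣ a − a′ ∣ for bits.
dot-self-exchange-pair : ∀ {n} {y α α′ : Vec ℕ n} → α ≤ᵥ indicator y → α′ ≤ᵥ indicator y →
  dot (exchange y α α′) (exchange y α α′) + dot (exchange y α′ α) (exchange y α′ α)
    ≡ dot y y + dot y y + 2 * dist α α′
dot-self-exchange-pair {y = []} {[]} {[]} [] [] = refl
dot-self-exchange-pair {y = u ∷ y} {a ∷ α} {a′ ∷ α′} (a≤ ∷ α≤) (a′≤ ∷ α′≤) = begin
  (s * s + dot t t) + (s′ * s′ + dot t′ t′)       ≡⟨ +-interchange (s * s) (dot t t) (s′ * s′) (dot t′ t′) ⟩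
  (s * s + s′ * s′) + (dot t t + dot t′ t′)
    ≡⟨ cong₂ _+_ (head u a≤ a′≤) (dot-self-exchange-pair α≤ α′≤) ⟩
  (u * u + u * u + 2 * ∣ a - a′ ∣) + (dot y y + dot y y + 2 * dist α α′)
    ≡⟨ regroup (u * u) (dot y y) (∣ a - a′ ∣) (dist α α′) ⟩
  (u * u + dot y y) + (u * u + dot y y) + 2 * (∣ a - a′ ∣ + dist α α′) ∎
  where
  open ≡-Reasoning
  s = u ∸ a + a′
  s′ = u ∸ a′ + a
  t = exchange y α α′
  t′ = exchange y α′ α
  regroup : ∀ p q e f → (p + p + 2 * e) + (q + q + 2 * f) ≡ (p + q) + (p + q) + 2 * (e + f)
  regroup = solve-∀
  head : ∀ u {a a′} → a ≤ 1 ⊓ u → a′ ≤ 1 ⊓ u →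
         (u ∸ a + a′) * (u ∸ a + a′) + (u ∸ a′ + a) * (u ∸ a′ + a) ≡ u * u + u * u + 2 * ∣ a - a′ ∣
  head zero    z≤n         z≤n         = refl
  head (suc v) z≤n         z≤n         = both v
    where both : ∀ v → (suc v + 0) * (suc v + 0) + (suc v + 0) * (suc v + 0) ≡ suc v * suc v + suc v * suc v + 2 * 0
          both = solve-∀
  head (suc v) (s≤s z≤n)   z≤n         = down v
    where down : ∀ v → (v + 0) * (v + 0) + (suc v + 1) * (suc v + 1) ≡ suc v * suc v + suc v * suc v + 2 * 1
          down = solve-∀
  head (suc v) z≤n         (s≤s z≤n)   = up v
    where up : ∀ v → (suc v + 1) * (suc v + 1) + (v + 0) * (v + 0) ≡ suc v * suc v + suc v * suc v + 2 * 1
          up = solve-∀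
  head (suc v) (s≤s z≤n)   (s≤s z≤n)   = both v
    where both : ∀ v → (v + 1) * (v + 1) + (v + 1) * (v + 1) ≡ suc v * suc v + suc v * suc v + 2 * 0
          both = solve-∀

dist-pos : ∀ {n} {α α′ : Vec ℕ n} → α ≢ α′ → 0 < dist α α′
dist-pos {α = []} {[]} α≢α′ = contradiction refl α≢α′
dist-pos {α = a ∷ α} {a′ ∷ α′} α≢α′ with a ≟ a′
... | yes refl = ≤-trans (dist-pos (α≢α′ ∘ cong (a ∷_))) (m≤n+m _ ∣ a - a ∣)
... | no a≢a′  = ≤-trans (n≢0⇒n>0 (a≢a′ ∘ ∣m-n∣≡0⇒m≡n)) (m≤m+n ∣ a - a′ ∣ _)

dot-self-exchange-pair-< : ∀ {n} {y α α′ : Vec ℕ n} → α ≤ᵥ indicator y → α′ ≤ᵥ indicator y → α ≢ α′ →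
  dot y y + dot y y < dot (exchange y α α′) (exchange y α α′) + dot (exchange y α′ α) (exchange y α′ α)
dot-self-exchange-pair-< {y = y} α≤ α′≤ α≢α′ =
  subst (dot y y + dot y y <_) (sym (dot-self-exchange-pair α≤ α′≤))
        (m<m+n (dot y y + dot y y) (<-≤-trans (dist-pos α≢α′) (m≤n*m _ 2)))

-- Boxes and the pigeonhole principle

box : ∀ {n} → Vec ℕ n → List (Vec ℕ n)
box []      = [ [] ]
box (a ∷ w) = cartesianProductWith _∷_ (upTo (suc a)) (box w)

length-cartesianProductWith : ∀ {A B C : Set} (f : A → B → C) (xs : List A) (ys : List B) →
  length (cartesianProductWith f xs ys) ≡ length xs * length ys
length-cartesianProductWith f List.[]       ys = refl
length-cartesianProductWith f (x List.∷ xs) ys = begin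
  length (List.map (f x) ys List.++ cartesianProductWith f xs ys)   ≡⟨ length-++ (List.map (f x) ys) ⟩
  length (List.map (f x) ys) + length (cartesianProductWith f xs ys)
    ≡⟨ cong₂ _+_ (length-map (f x) ys) (length-cartesianProductWith f xs ys) ⟩
  length ys + length xs * length ys                                 ∎
  where open ≡-Reasoning

length-box : ∀ {n} (a : ℕ) (w : Vec ℕ n) → length (box (a ∷ w)) ≡ suc a * length (box w)
length-box a w = trans (length-cartesianProductWith _∷_ (upTo (suc a)) (box w))
                       (cong (_* length (box w)) (length-upTo (suc a)))

length-box-replicate : ∀ n B → length (box (replicate n B)) ≡ suc B ^ n
length-box-replicate zero    B = refl
length-box-replicate (suc n) B = trans (length-box B (replicate n B)) (cong (suc B *_) (length-box-replicate n B))

length-box-indicator : ∀ {n} (w : Vec ℕ n) → length (box (indicator w)) ≡ 2 ^ suppSize w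
length-box-indicator []          = refl
length-box-indicator (zero  ∷ w) = trans (length-box 0 (indicator w)) (trans (+-identityʳ _) (length-box-indicator w))
length-box-indicator (suc _ ∷ w) = trans (length-box 1 (indicator w)) (cong (2 *_) (length-box-indicator w))

box-unique : ∀ {n} (w : Vec ℕ n) → Unique (box w)
box-unique []      = All.[] ∷ []
box-unique (a ∷ w) = Unique.cartesianProductWith⁺ _∷_ Vec.∷-injective (Unique.upTo⁺ (suc a)) (box-unique w)

∈-box⁻ : ∀ {n} (w : Vec ℕ n) {v} → v ∈ box w → v ≤ᵥ w
∈-box⁻ []      (here refl) = []
∈-box⁻ (a ∷ w) v∈box with _ , _ , i∈ , u∈ , refl ← ∈-cartesianProductWith⁻ _∷_ (upTo (suc a)) (box w) v∈box
  = ≤-pred (∈-upTo⁻ i∈) ∷ ∈-box⁻ w u∈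

∈-box-replicate : ∀ {n B} (v : Vec ℕ n) → (∀ i → lookup v i ≤ B) → v ∈ box (replicate n B)
∈-box-replicate []      _     = here refl
∈-box-replicate (a ∷ v) v≤B = ∈-cartesianProductWith⁺ _∷_ (∈-upTo⁺ (s≤s (v≤B zero))) (∈-box-replicate v (v≤B ∘ suc))

lookup-injective : ∀ {A : Set} {xs : List A} → Unique xs →
                   ∀ {i j : Fin (length xs)} → i Fin.< j → List.lookup xs i ≢ List.lookup xs j
lookup-injective (x∉xs ∷ _) {zero}  {suc j} _         = All.lookup x∉xs (∈-lookup j)
lookup-injective (_ ∷ uniq) {suc i} {suc j} (s≤s i<j) = lookup-injective uniq i<j

pigeonhole : ∀ {A B : Set} {xs : List A} → Unique xs → (ys : List B) → length ys < length xs →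
             (f : A → B) → (∀ {x} → x ∈ xs → f x ∈ ys) →
             ∃ λ a → ∃ λ b → a ∈ xs × b ∈ xs × a ≢ b × f a ≡ f b
pigeonhole {xs = xs} uniq ys short f into
  with i , j , i<j , same ← Fin.pigeonhole short (λ i → Any.index (into (∈-lookup i)))
  = List.lookup xs i , List.lookup xs j , ∈-lookup i , ∈-lookup j , lookup-injective uniq i<j ,
    trans (lookup-index (into (∈-lookup i))) (trans (cong (List.lookup ys) same) (sym (lookup-index (into (∈-lookup j)))))

bit-collision : ∀ {n} {B : Set} (w : Vec ℕ n) (ys : List B) → length ys < 2 ^ suppSize w →
                (f : Vec ℕ n → B) → (∀ {α} → α ≤ᵥ indicator w → f α ∈ ys) →
                ∃ λ α → ∃ λ α′ → α ≤ᵥ indicator w × α′ ≤ᵥ indicator w × α ≢ α′ × f α ≡ f α′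
bit-collision w ys short f into
  with α , α′ , α∈ , α′∈ , α≢α′ , same ←
       pigeonhole (box-unique (indicator w)) ys (subst (length ys <_) (sym (length-box-indicator w)) short)
                  f (into ∘ ∈-box⁻ (indicator w))
  = α , α′ , ∈-box⁻ (indicator w) α∈ , ∈-box⁻ (indicator w) α′∈ , α≢α′ , same

^-distribʳ-* : ∀ a b k → (a * b) ^ k ≡ a ^ k * b ^ k
^-distribʳ-* a b zero    = refl
^-distribʳ-* a b (suc k) = trans (cong (a * b *_) (^-distribʳ-* a b k)) (*-interchange a b (a ^ k) (b ^ k))

n<2^n : ∀ n → n < 2 ^ n
n<2^n zero    = s≤s z≤n
n<2^n (suc n) = +-mono-≤ (m^n>0 2 n) (≤-trans (n<2^n n) (m≤m+n (2 ^ n) 0))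

log-bound : ∀ n s T → 1 ≤ T → 2 ^ s ≤ suc (s * T) ^ suc n → 2 ^ s ≤ (4 * suc n * T) ^ (2 * suc n)
log-bound n s T 1≤T 2^s≤ = begin
  2 ^ s            ≤⟨ 2^s≤XY ⟩
  X * Y            ≤⟨ *-monoˡ-≤ Y X≤Y ⟩
  Y * Y            ≡⟨ ^-distribˡ-+-* (M * T) N N ⟨
  (M * T) ^ (N + N) ≡⟨ cong ((M * T) ^_) (cong (N +_) (+-identityʳ N)) ⟨
  (M * T) ^ M      ≤⟨ ^-monoˡ-≤ M (*-monoˡ-≤ T (*-monoˡ-≤ N (m≤m+n 2 2))) ⟩
  (4 * N * T) ^ M  ∎
  where
  open ≤-Reasoning
  N = suc n
  M = 2 * N
  -- with q = ⌊s / M⌋ we get 2^s ≤ X·Y and X·X = 2^(qM) ≤ 2^s, hence X ≤ Y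
  q = s / M
  X = 2 ^ (q * N)
  Y = (M * T) ^ N
  s+1≤[q+1]M : suc s ≤ suc q * M
  s+1≤[q+1]M = begin
    suc s             ≡⟨ cong suc (m≡m%n+[m/n]*n s M) ⟩
    suc (s % M) + q * M ≤⟨ +-monoˡ-≤ (q * M) (m%n<n s M) ⟩
    M + q * M         ∎
  sT+1≤2^qMT : suc (s * T) ≤ 2 ^ q * (M * T)
  sT+1≤2^qMT = begin
    suc (s * T)       ≤⟨ +-monoˡ-≤ (s * T) 1≤T ⟩
    suc s * T         ≤⟨ *-monoˡ-≤ T s+1≤[q+1]M ⟩
    suc q * M * T     ≤⟨ *-monoˡ-≤ T (*-monoˡ-≤ M (n<2^n q)) ⟩
    2 ^ q * M * T     ≡⟨ *-assoc (2 ^ q) M T ⟩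
    2 ^ q * (M * T)   ∎
  2^s≤XY : 2 ^ s ≤ X * Y
  2^s≤XY = begin
    2 ^ s                   ≤⟨ 2^s≤ ⟩
    suc (s * T) ^ N         ≤⟨ ^-monoˡ-≤ N sT+1≤2^qMT ⟩
    (2 ^ q * (M * T)) ^ N   ≡⟨ ^-distribʳ-* (2 ^ q) (M * T) N ⟩
    (2 ^ q) ^ N * Y         ≡⟨ cong (_* Y) (^-*-assoc 2 q N) ⟩
    X * Y                   ∎
  double : ∀ q N → q * (2 * N) ≡ q * N + q * N
  double = solve-∀
  XX≤2^s : X * X ≤ 2 ^ s
  XX≤2^s = begin
    X * X              ≡⟨ ^-distribˡ-+-* 2 (q * N) (q * N) ⟨
    2 ^ (q * N + q * N) ≡⟨ cong (2 ^_) (double q N) ⟨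
    2 ^ (q * M)        ≤⟨ ^-monoʳ-≤ 2 (≤-trans (m≤n+m (q * M) (s % M)) (≤-reflexive (sym (m≡m%n+[m/n]*n s M)))) ⟩
    2 ^ s              ∎
  X≤Y : X ≤ Y
  X≤Y = *-cancelˡ-≤ X {{m^n≢0 2 (q * N)}} (≤-trans XX≤2^s 2^s≤XY)

larger-of-two : ∀ {a b c} → a + a < b + c → a < b ⊎ a < c
larger-of-two {a} {b} {c} a+a<b+c with a <? b | a <? c
... | yes a<b | _       = inj₁ a<b
... | no _    | yes a<c = inj₂ a<c
... | no a≮b  | no a≮c  = contradiction (+-mono-≤ (≮⇒≥ a≮b) (≮⇒≥ a≮c)) (<⇒≱ a+a<b+c)

bounded-ascent : ∀ {A : Set} {Inv Done : A → Set} (Φ : A → ℕ) (bound : ℕ) →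
                 (∀ a → Inv a → Φ a ≤ bound) →
                 (∀ a → Inv a → Done a ⊎ ∃ λ a′ → Inv a′ × Φ a < Φ a′) →
                 ∀ a → Inv a → ∃ λ a → Inv a × Done a
bounded-ascent {A} {Inv} {Done} Φ bound bounded step a inv =
  climb (suc bound) a inv (≤-trans (n<1+n bound) (m≤n+m (suc bound) (Φ a)))
  where
  climb : ∀ fuel a → Inv a → bound < Φ a + fuel → ∃ λ a → Inv a × Done a
  climb zero       a inv above = contradiction (bounded a inv) (<⇒≱ (subst (bound <_) (+-identityʳ (Φ a)) above))
  climb (suc fuel) a inv above with step a inv
  ... | inj₁ done             = a , inv , done
  ... | inj₂ (a′ , inv′ , up) =
    climb fuel a′ inv′ (≤-trans above (≤-trans (≤-reflexive (+-suc (Φ a) fuel)) (+-monoˡ-≤ fuel up)))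

-- Coefficient vectors along a list

along : ∀ {A B : Set} (L : List A) → (A → B) → Vec B (length L)
along L g = tabulate (g ∘ List.lookup L)

along-cong : ∀ {A B : Set} (L : List A) {f g : A → B} → (∀ {c} → c ∈ L → f c ≡ g c) → along L f ≡ along L g
along-cong L f≗g = Vec.tabulate-cong (λ j → f≗g (∈-lookup j))

lookup-along : ∀ {A B : Set} (L : List A) (g : A → B) j → lookup (along L g) j ≡ g (List.lookup L j)
lookup-along L g = Vec.lookup∘tabulate (g ∘ List.lookup L)

dot-along-units : ∀ {A : Set} (L : List A) (g : A → ℕ) j j′ →
                  dot (along L g) (unit j ⊕ unit j′) ≡ g (List.lookup L j) + g (List.lookup L j′)
dot-along-units L g j j′ = trans (dot-⊕ (along L g) (unit j) (unit j′))
  (cong₂ _+_ (trans (dot-unit (along L g) j) (lookup-along L g j)) (trans (dot-unit (along L g) j′) (lookup-along L g j′)))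

restrict : ∀ {A : Set} {P : A → Set} → Decidable P → (L : List A) → Vec ℕ (length L) → Vec ℕ (length L)
restrict P? L y = tabulate λ j → if does (P? (List.lookup L j)) then lookup y j else 0

restrict-≤ : ∀ {A : Set} {P : A → Set} (P? : Decidable P) (L : List A) (y : Vec ℕ (length L)) → restrict P? L y ≤ᵥ y
restrict-≤ P? L y = subst (restrict P? L y ≤ᵥ_) (Vec.tabulate∘lookup y) (Pointwise.tabulate⁺ entry)
  where
  entry : ∀ j → (if does (P? (List.lookup L j)) then lookup y j else 0) ≤ lookup y j
  entry j with does (P? (List.lookup L j))
  ... | true  = ≤-refl
  ... | false = z≤n

lookup-restrict-≤ : ∀ {A : Set} {P : A → Set} (P? : Decidable P) (L : List A) (y : Vec ℕ (length L)) {B} j →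
                    (P (List.lookup L j) → lookup y j ≤ B) → lookup (restrict P? L y) j ≤ B
lookup-restrict-≤ P? L y {B} j bound = ≤-trans (≤-reflexive (Vec.lookup∘tabulate _ j)) entry
  where
  entry : (if does (P? (List.lookup L j)) then lookup y j else 0) ≤ B
  entry with P? (List.lookup L j)
  ... | yes p = bound p
  ... | no _  = z≤n

total-along : ∀ {d} (L : List (Vec ℕ d)) x → total L x ≡ Vec.sum (along L x)
total-along List.[]       x = refl
total-along (c List.∷ L) x = cong (x c +_) (total-along L x)

total-filter : ∀ {d} {P : Vec ℕ d → Set} (P? : Decidable P) (L : List (Vec ℕ d)) x →
               total (filter P? L) x ≡ Vec.sum (restrict P? L (along L x))
total-filter P? List.[]       x = refl
total-filter P? (c List.∷ L) x with does (P? c)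
... | true  = cong (x c +_) (total-filter P? L x)
... | false = total-filter P? L x

suppSize-along : ∀ {d} (L : List (Vec ℕ d)) x → length (filter (λ c → ¬? (x c ≟ 0)) L) ≡ suppSize (along L x)
suppSize-along List.[]       x = refl
suppSize-along (c List.∷ L) x with x c
... | zero  = suppSize-along L x
... | suc _ = cong suc (suppSize-along L x)

lookup-weightedSum : ∀ {d} (L : List (Vec ℕ d)) x i →
                     lookup (weightedSum L x) i ≡ dot (along L (λ c → lookup c i)) (along L x)
lookup-weightedSum List.[]       x i = Vec.lookup-replicate i 0
lookup-weightedSum (c List.∷ L) x i = begin
  lookup (Vec.map (x c *_) c ⊕ weightedSum L x) i          ≡⟨ Vec.lookup-zipWith _+_ i (Vec.map (x c *_) c) _ ⟩
  lookup (Vec.map (x c *_) c) i + lookup (weightedSum L x) i ≡⟨ cong₂ _+_ (Vec.lookup-map i (x c *_) c) (lookup-weightedSum L x i) ⟩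
  x c * lookup c i + rest                                    ≡⟨ cong (_+ rest) (*-comm (x c) (lookup c i)) ⟩
  lookup c i * x c + rest                                    ∎
  where
  open ≡-Reasoning
  rest = dot (along L (λ c → lookup c i)) (along L x)

extend : ∀ {A : Set} → DecidableEquality A → (L : List A) → Vec ℕ (length L) → A → ℕ
extend _≟_ List.[]        []      c = 0
extend _≟_ (c′ List.∷ L) (k ∷ y) c = if does (c ≟ c′) then k else extend _≟_ L y c

along-extend : ∀ {A : Set} (_≟_ : DecidableEquality A) (L : List A) → Unique L →
               ∀ y → along L (extend _≟_ L y) ≡ y
along-extend _≟_ List.[]        []                []      = refl
along-extend _≟_ (c′ List.∷ L) (c′∉L ∷ uniq) (k ∷ y) = cong₂ _∷_ head
  (trans (along-cong L tail) (along-extend _≟_ L uniq y))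
  where
  head : extend _≟_ (c′ List.∷ L) (k ∷ y) c′ ≡ k
  head with c′ ≟ c′
  ... | yes _   = refl
  ... | no c′≢c′ = contradiction refl c′≢c′
  tail : ∀ {c} → c ∈ L → extend _≟_ (c′ List.∷ L) (k ∷ y) c ≡ extend _≟_ L y c
  tail {c} c∈L with c ≟ c′
  ... | yes refl = contradiction refl (All.lookup c′∉L c∈L)
  ... | no _     = refl

-- The configuration IP

module ConfigurationIP {d : ℕ} (π : Vec ℕ d) (π>0 : ∀ i → 0 < lookup π i) (T : ℕ) (1≤T : 1 ≤ T)
                       (L : List (Vec ℕ d)) (∈L⇒ : ∀ {c} → c ∈ L → dot π c ≤ T)
                       (⇒∈L : ∀ {c} → dot π c ≤ T → c ∈ L) where

  N : ℕ
  N = length L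

  -- the constraint matrix of [conf-IP] has the column 1 ∷ c for every configuration c
  row : Fin (suc d) → Vec ℕ N
  row i = along L (λ c → lookup (1 ∷ c) i)

  image : Vec ℕ N → Vec ℕ (suc d)
  image y = tabulate λ i → dot (row i) y

  weights : Vec ℕ N
  weights = along L (λ c → dot c c)

  energy : Vec ℕ N → ℕ
  energy = dot weights

  complexPart : Vec ℕ N → Vec ℕ N
  complexPart = restrict (λ c → ¬? (simple? T c)) L

  Sparse : Vec ℕ N → Set
  Sparse w = 2 ^ suppSize w ≤ suc (suppSize w * T) ^ suc d

  sparse? : ∀ w → Dec (Sparse w)
  sparse? w = 2 ^ suppSize w ≤? suc (suppSize w * T) ^ suc d

  NoHeavyComplex : Vec ℕ N → Set
  NoHeavyComplex y = ∀ j → 1 < lookup y j → Simple T (List.lookup L j)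

  Good : Vec ℕ N → Set
  Good y = NoHeavyComplex y × Sparse y × Sparse (complexPart y)

  sum-≤ : ∀ j → Vec.sum (List.lookup L j) ≤ T
  sum-≤ j = ≤-trans (sum-≤-dot π (List.lookup L j) π>0) (∈L⇒ (∈-lookup j))

  row-≤ : ∀ i j → lookup (row i) j ≤ T
  row-≤ i j = ≤-trans (≤-reflexive (lookup-along L (λ c → lookup (1 ∷ c) i) j)) (column-≤ i)
    where
    column-≤ : ∀ i → lookup (1 ∷ List.lookup L j) i ≤ T
    column-≤ zero    = 1≤T
    column-≤ (suc i) = ≤-trans (lookup-≤-sum (List.lookup L j) i) (sum-≤ j)

  weights-≤ : ∀ j → lookup weights j ≤ T * T
  weights-≤ j = ≤-trans (≤-reflexive (lookup-along L (λ c → dot c c) j))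
                        (≤-trans (dot-self-≤ (List.lookup L j)) (*-mono-≤ (sum-≤ j) (sum-≤ j)))

  lookup-image : ∀ {α α′} → image α ≡ image α′ → ∀ i → dot (row i) α ≡ dot (row i) α′
  lookup-image {α} {α′} eq i =
    trans (sym (Vec.lookup∘tabulate (λ i → dot (row i) α) i))
          (trans (cong (λ v → lookup v i) eq) (Vec.lookup∘tabulate (λ i → dot (row i) α′) i))

  image-exchange : ∀ {y α α′} → α ≤ᵥ y → (∀ i → dot (row i) α ≡ dot (row i) α′) → image (exchange y α α′) ≡ image y
  image-exchange α≤y balanced = Vec.tabulate-cong λ i → dot-exchange-invariant (row i) α≤y (balanced i)

  module Potential (K : ℕ) where

    Φ : Vec ℕ N → ℕ
    Φ y = K * energy y + dot y y

    Improvement : Vec ℕ N → Set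
    Improvement y = ∃ λ y′ → image y′ ≡ image y × Φ y < Φ y′

    Φ-pair : ∀ {y y₁ y₂} → energy y₁ + energy y₂ ≡ energy y + energy y →
             dot y y + dot y y < dot y₁ y₁ + dot y₂ y₂ → Φ y + Φ y < Φ y₁ + Φ y₂
    Φ-pair {y} {y₁} {y₂} energies squares = begin-strict
      (K * e + n) + (K * e + n)         ≡⟨ +-interchange (K * e) n (K * e) n ⟩
      (K * e + K * e) + (n + n)         ≡⟨ cong (_+ (n + n)) (*-distribˡ-+ K e e) ⟨
      K * (e + e) + (n + n)             <⟨ +-monoʳ-< (K * (e + e)) squares ⟩
      K * (e + e) + (n₁ + n₂)           ≡⟨ cong (λ t → K * t + (n₁ + n₂)) energies ⟨
      K * (e₁ + e₂) + (n₁ + n₂)         ≡⟨ cong (_+ (n₁ + n₂)) (*-distribˡ-+ K e₁ e₂) ⟩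
      (K * e₁ + K * e₂) + (n₁ + n₂)     ≡⟨ +-interchange (K * e₁) (K * e₂) n₁ n₂ ⟩
      (K * e₁ + n₁) + (K * e₂ + n₂)     ∎
      where
      open ≤-Reasoning
      e = energy y
      e₁ = energy y₁
      e₂ = energy y₂
      n = dot y y
      n₁ = dot y₁ y₁
      n₂ = dot y₂ y₂

    exchange-bits : ∀ y {α α′} → α ≤ᵥ indicator y → α′ ≤ᵥ indicator y → α ≢ α′ →
                    image α ≡ image α′ → Improvement y
    exchange-bits y {α} {α′} α≤ α′≤ α≢α′ same =
      Sum.[ (λ up → y₁ , image-exchange α≤y (lookup-image same) , up)
          , (λ up → y₂ , image-exchange α′≤y (lookup-image (sym same)) , up) ]′
        (larger-of-two (Φ-pair (dot-exchange-pair weights α≤y α′≤y)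
                               (dot-self-exchange-pair-< α≤ α′≤ α≢α′)))
      where
      α≤y = Pointwise.trans ≤-trans α≤ (indicator-≤ y)
      α′≤y = Pointwise.trans ≤-trans α′≤ (indicator-≤ y)
      y₁ = exchange y α α′
      y₂ = exchange y α′ α

    exchange-dense : ∀ {w y} → w ≤ᵥ y → ¬ Sparse w → Improvement y
    exchange-dense {w} {y} w≤y dense =
      let α , α′ , α≤ , α′≤ , α≢α′ , same = bit-collision w (box (replicate (suc d) B)) short image into
      in exchange-bits y (lift α≤) (lift α′≤) α≢α′ same
      where
      B = suppSize w * T
      lift : ∀ {α} → α ≤ᵥ indicator w → α ≤ᵥ indicator y
      lift α≤ = Pointwise.trans ≤-trans α≤ (indicator-mono-≤ w≤y)
      short : length (box (replicate (suc d) B)) < 2 ^ suppSize w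
      short = subst (_< 2 ^ suppSize w) (sym (length-box-replicate (suc d) B)) (≰⇒> dense)
      into : ∀ {α} → α ≤ᵥ indicator w → image α ∈ box (replicate (suc d) B)
      into {α} α≤ = ∈-box-replicate (image α) λ i → begin
        lookup (image α) i ≡⟨ Vec.lookup∘tabulate (λ i → dot (row i) α) i ⟩
        dot (row i) α      ≤⟨ dot-≤-sum (row i) α (row-≤ i) ⟩
        T * Vec.sum α      ≤⟨ *-monoʳ-≤ T (≤-trans (sum-mono-≤ α≤) (≤-reflexive (sum-indicator w))) ⟩
        T * suppSize w     ≡⟨ *-comm T (suppSize w) ⟩
        B                  ∎
        where open ≤-Reasoning

    split : ∀ y → dot y y < K → ∀ j → 2 ≤ lookup y j → ∀ {e e′} →
            e ≤ᵥ indicator (List.lookup L j) → e′ ≤ᵥ indicator (List.lookup L j) → e ≢ e′ →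
            dot π e ≡ dot π e′ → Improvement y
    split y small j heavy {e} {e′} e≤ e′≤ e≢e′ same = y′ , image-exchange α≤y balanced , Φ-up
      where
      c = List.lookup L j
      e≤c = Pointwise.trans ≤-trans e≤ (indicator-≤ c)
      e′≤c = Pointwise.trans ≤-trans e′≤ (indicator-≤ c)
      c₁ = exchange c e e′
      c₂ = exchange c e′ e
      c₁∈L : c₁ ∈ L
      c₁∈L = ⇒∈L (subst (_≤ T) (sym (dot-exchange-invariant π e≤c same)) (∈L⇒ (∈-lookup j)))
      c₂∈L : c₂ ∈ L
      c₂∈L = ⇒∈L (subst (_≤ T) (sym (dot-exchange-invariant π e′≤c (sym same))) (∈L⇒ (∈-lookup j)))
      α = unit j ⊕ unit j
      α′ = unit (Any.index c₁∈L) ⊕ unit (Any.index c₂∈L)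
      α≤y = unit⊕unit-≤ y j heavy
      y′ = exchange y α α′
      on-α′ : ∀ g → dot (along L g) α′ ≡ g c₁ + g c₂
      on-α′ g = trans (dot-along-units L g _ _) (sym (cong₂ _+_ (cong g (lookup-index c₁∈L)) (cong g (lookup-index c₂∈L))))
      columns : (1 ∷ c₁) ⊕ (1 ∷ c₂) ≡ (1 ∷ c) ⊕ (1 ∷ c)
      columns = exchange-pair {y = 1 ∷ c} {0 ∷ e} {0 ∷ e′} (z≤n ∷ e≤c) (z≤n ∷ e′≤c)
      balanced : ∀ i → dot (row i) α ≡ dot (row i) α′
      balanced i = begin
        dot (row i) α                          ≡⟨ dot-along-units L (λ c → lookup (1 ∷ c) i) j j ⟩
        lookup (1 ∷ c) i + lookup (1 ∷ c) i    ≡⟨ Vec.lookup-zipWith _+_ i (1 ∷ c) (1 ∷ c) ⟨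
        lookup ((1 ∷ c) ⊕ (1 ∷ c)) i           ≡⟨ cong (λ v → lookup v i) columns ⟨
        lookup ((1 ∷ c₁) ⊕ (1 ∷ c₂)) i         ≡⟨ Vec.lookup-zipWith _+_ i (1 ∷ c₁) (1 ∷ c₂) ⟩
        lookup (1 ∷ c₁) i + lookup (1 ∷ c₂) i  ≡⟨ on-α′ (λ c → lookup (1 ∷ c) i) ⟨
        dot (row i) α′                         ∎
        where open ≡-Reasoning
      energy-up : energy y < energy y′
      energy-up = +-cancelʳ-< (dot c c + dot c c) (energy y) (energy y′) (begin-strict
        energy y + (dot c c + dot c c)     <⟨ +-monoʳ-< (energy y) (dot-self-exchange-pair-< e≤ e′≤ e≢e′) ⟩
        energy y + (dot c₁ c₁ + dot c₂ c₂) ≡⟨ cong (energy y +_) (on-α′ (λ c → dot c c)) ⟨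
        energy y + energy α′               ≡⟨ dot-exchange weights α′ α≤y ⟨
        energy y′ + energy α               ≡⟨ cong (energy y′ +_) (dot-along-units L (λ c → dot c c) j j) ⟩
        energy y′ + (dot c c + dot c c)    ∎)
        where open ≤-Reasoning
      Φ-up : Φ y < Φ y′
      Φ-up = begin-strict
        K * energy y + dot y y  <⟨ +-monoʳ-< (K * energy y) small ⟩
        K * energy y + K        ≡⟨ +-comm (K * energy y) K ⟩
        K + K * energy y        ≡⟨ *-suc K (energy y) ⟨
        K * suc (energy y)      ≤⟨ *-monoʳ-≤ K energy-up ⟩
        K * energy y′           ≤⟨ m≤m+n (K * energy y′) (dot y′ y′) ⟩
        Φ y′                    ∎
        where open ≤-Reasoning

    split-heavy : ∀ y → dot y y < K → ∀ j → 1 < lookup y j → ¬ Simple T (List.lookup L j) → Improvement y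
    split-heavy y small j heavy complex =
      let e , e′ , e≤ , e′≤ , e≢e′ , same = bit-collision c (upTo (suc T)) short (dot π) into
      in split y small j heavy e≤ e′≤ e≢e′ same
      where
      c = List.lookup L j
      short : length (upTo (suc T)) < 2 ^ suppSize c
      short = subst₂ _<_ (trans (+-comm T 1) (sym (length-upTo (suc T)))) refl (≰⇒> complex)
      into : ∀ {e} → e ≤ᵥ indicator c → dot π e ∈ upTo (suc T)
      into e≤ = ∈-upTo⁺ (s≤s (≤-trans (dot-monoʳ-≤ π (Pointwise.trans ≤-trans e≤ (indicator-≤ c)))
                                      (∈L⇒ (∈-lookup j))))

    improve-or-good : ∀ y → dot y y < K → Good y ⊎ Improvement y
    improve-or-good y small with Fin.any? (λ j → (1 <? lookup y j) ×-dec ¬? (simple? T (List.lookup L j)))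
    ... | yes (j , heavy , complex) = inj₂ (split-heavy y small j heavy complex)
    ... | no none with sparse? y | sparse? (complexPart y)
    ...   | no dense   | _           = inj₂ (exchange-dense (Pointwise.refl ≤-refl) dense)
    ...   | yes _      | no dense    = inj₂ (exchange-dense (restrict-≤ (λ c → ¬? (simple? T c)) L y) dense)
    ...   | yes sparse | yes sparse′ = inj₁ (no-heavy , sparse , sparse′)
      where
      no-heavy : NoHeavyComplex y
      no-heavy j heavy with simple? T (List.lookup L j)
      ... | yes simple  = simple
      ... | no complex  = contradiction (j , heavy , complex) none

  good-solution : ∀ y₀ → ∃ λ y → image y ≡ image y₀ × Good y
  good-solution y₀ = bounded-ascent Φ bound bounded step y₀ refl
    where
    m = Vec.sum y₀
    K = suc (m * m)
    open Potential K
    sum-fixed : ∀ {y} → image y ≡ image y₀ → Vec.sum y ≡ m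
    sum-fixed {y} eq = trans (sym (dot-ones y)) (trans (lookup-image eq zero) (dot-ones y₀))
    squares-≤ : ∀ {y} → image y ≡ image y₀ → dot y y ≤ m * m
    squares-≤ {y} eq = subst (λ s → dot y y ≤ s * s) (sum-fixed eq) (dot-self-≤ y)
    bound = K * (T * T * m) + m * m
    bounded : ∀ y → image y ≡ image y₀ → Φ y ≤ bound
    bounded y eq = +-mono-≤ (*-monoʳ-≤ K energy-≤) (squares-≤ eq)
      where
      energy-≤ : energy y ≤ T * T * m
      energy-≤ = subst (λ s → energy y ≤ T * T * s) (sum-fixed eq)
        (dot-≤-sum weights y weights-≤)
    step : ∀ y → image y ≡ image y₀ → Good y ⊎ ∃ λ y′ → image y′ ≡ image y₀ × Φ y < Φ y′
    step y eq = Sum.map₂ (λ (y′ , eq′ , up) → y′ , trans eq′ eq , up) (improve-or-good y (s≤s (squares-≤ eq)))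

  image-along : ∀ x → image (along L x) ≡ total L x ∷ weightedSum L x
  image-along x = cong₂ _∷_ (trans (dot-ones (along L x)) (sym (total-along L x)))
    (trans (Vec.tabulate-cong (λ i → sym (lookup-weightedSum L x i))) (Vec.tabulate∘lookup (weightedSum L x)))

  complexPart-≤1 : ∀ {y} → NoHeavyComplex y → ∀ j → lookup (complexPart y) j ≤ 1
  complexPart-≤1 {y} no-heavy j =
    lookup-restrict-≤ (λ c → ¬? (simple? T c)) L y j (λ complex → ≮⇒≥ (complex ∘ no-heavy j))

  no-heavy-complex : ∀ x → NoHeavyComplex (along L x) → ∀ c → c ∈ L → 1 < x c → Simple T c
  no-heavy-complex x no-heavy c c∈L 1<xc =
    subst (Simple T) (sym c≡) (no-heavy j (subst (1 <_) (trans (cong x c≡) (sym (lookup-along L x j))) 1<xc))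
    where
    j = Any.index c∈L
    c≡ = lookup-index c∈L

  good-assignment : Unique L → ∀ x₀ → ∃ λ x → image (along L x) ≡ image (along L x₀) × Good (along L x)
  good-assignment uniq x₀ =
    let y , same , good = good-solution (along L x₀)
        along-x≡y = along-extend (Vec.≡-dec _≟_) L uniq y
    in extend (Vec.≡-dec _≟_) L y , trans (cong image along-x≡y) same , subst Good (sym along-x≡y) good

concatMap-map≡cartesianProductWith : ∀ {A B C : Set} (f : A → B → C) xs ys →
  List.concatMap (λ a → List.map (f a) ys) xs ≡ cartesianProductWith f xs ys
concatMap-map≡cartesianProductWith f List.[]       ys = refl
concatMap-map≡cartesianProductWith f (x List.∷ xs) ys =
  cong (List.map (f x) ys List.++_) (concatMap-map≡cartesianProductWith f xs ys)

allVecs≡box : ∀ d T → allVecs d T ≡ box (replicate d T)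
allVecs≡box zero    T = refl
allVecs≡box (suc d) T = trans (concatMap-map≡cartesianProductWith _∷_ (upTo (suc T)) (allVecs d T))
                              (cong (cartesianProductWith _∷_ (upTo (suc T))) (allVecs≡box d T))

Q-unique : ∀ {d} (π : Vec ℕ d) T → Unique (Q π T)
Q-unique {d} π T = Unique.filter⁺ (λ c → dot π c ≤? T) (subst Unique (sym (allVecs≡box d T)) (box-unique (replicate d T)))

∈Q⇒ : ∀ {d} (π : Vec ℕ d) T {c} → c ∈ Q π T → dot π c ≤ T
∈Q⇒ {d} π T c∈Q = proj₂ (∈-filter⁻ (λ c → dot π c ≤? T) {xs = allVecs d T} c∈Q)

⇒∈Q : ∀ {d} (π : Vec ℕ d) T → (∀ i → 0 < lookup π i) → ∀ {c} → dot π c ≤ T → c ∈ Q π T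
⇒∈Q {d} π T π>0 {c} πc≤T = ∈-filter⁺ (λ c → dot π c ≤? T) (subst (c ∈_) (sym (allVecs≡box d T)) c∈box) πc≤T
  where c∈box = ∈-box-replicate c (λ i → ≤-trans (lookup-≤-sum c i) (≤-trans (sum-≤-dot π c π>0) πc≤T))

theorem1 : (d : ℕ) → 1 ≤ d → (π : Vec ℕ d) → ((i : Fin d) → 0 < lookup π i) →
           (T : ℕ) → 1 ≤ T → (b : Vec ℤ d) → (m : ℕ) →
           Σ (Vec ℕ d → ℕ) (λ x → Feasible π T b m x) →
           Σ (Vec ℕ d → ℕ) (λ x → Feasible π T b m x
             × ((c : Vec ℕ d) → c ∈ Q π T → 1 < x c → Simple T c)
             × (2 ^ suppX π T x ≤ (4 * (d + 1) * T) ^ (4 * (d + 1)))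
             × (2 ^ total (complexConfigs π T) x ≤ (4 * (d + 1) * T) ^ (2 * (d + 1))))
-- The argument does not need d ≥ 1.
theorem1 d _ π π>0 T 1≤T b m (x₀ , feasible₀) =
  let x , same , no-heavy , sparse , sparse-complex = good-assignment (Q-unique π T) x₀
  in x , feasible same , no-heavy-complex x no-heavy , supp-bound x sparse ,
     complex-bound x no-heavy sparse-complex
  where
  open ConfigurationIP π π>0 T 1≤T (Q π T) (∈Q⇒ π T) (⇒∈Q π T π>0)
  L = Q π T
  B = 4 * (d + 1) * T
  feasible : ∀ {x} → image (along L x) ≡ image (along L x₀) → Feasible π T b m x
  feasible {x} same =
    let total≡ , weightedSum≡ = Vec.∷-injective (trans (sym (image-along x)) (trans same (image-along x₀)))
    in trans (cong (Vec.map (ℤ.+_)) weightedSum≡) (proj₁ feasible₀) , trans total≡ (proj₂ feasible₀)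
  exponent-bound : ∀ s → 2 ^ s ≤ suc (s * T) ^ suc d → 2 ^ s ≤ B ^ (2 * (d + 1))
  exponent-bound s sparse = subst (λ n → 2 ^ s ≤ (4 * n * T) ^ (2 * n)) (+-comm 1 d) (log-bound d s T 1≤T sparse)
  supp-bound : ∀ x → Sparse (along L x) → 2 ^ suppX π T x ≤ B ^ (4 * (d + 1))
  supp-bound x sparse = begin
    2 ^ suppX π T x              ≡⟨ cong (2 ^_) (suppSize-along L x) ⟩
    2 ^ suppSize (along L x)     ≤⟨ exponent-bound (suppSize (along L x)) sparse ⟩
    B ^ (2 * (d + 1))            ≤⟨ ^-monoʳ-≤ B {{B≢0}} (*-monoˡ-≤ (d + 1) (m≤m+n 2 2)) ⟩
    B ^ (4 * (d + 1))            ∎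
    where
    open ≤-Reasoning
    B≢0 = >-nonZero (*-mono-≤ (≤-trans (m≤n+m 1 d) (m≤m+n (d + 1) (3 * (d + 1)))) 1≤T)
  complex-bound : ∀ x → NoHeavyComplex (along L x) → Sparse (complexPart (along L x)) →
                  2 ^ total (complexConfigs π T) x ≤ B ^ (2 * (d + 1))
  complex-bound x no-heavy sparse =
    ≤-trans (^-monoʳ-≤ 2 total≤supp) (exponent-bound (suppSize (complexPart (along L x))) sparse)
    where
    total≤supp : total (complexConfigs π T) x ≤ suppSize (complexPart (along L x))
    total≤supp = ≤-trans (≤-reflexive (total-filter (λ c → ¬? (simple? T c)) L x))
                         (sum-≤-suppSize (complexPart (along L x)) (complexPart-≤1 {along L x} no-heavy))
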